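{- Let $r\ge 1$ and let $f\in F_r$ with $f^{ -1}(\times)=\{a_1<\cdots<a_r\}$; put $a=a_r$. Let $\bar f\in F_{r-1}$ be the function with $\bar f^{ -1}(\times)=\{a_1,\ldots,a_{r-1}\}$. Then the map sending $g\in\flat\bar f$ to the function $h\in F$ with $h^{ -1}(\times)=g^{ -1}(\times)\cup\{a\}$ (i.e. if $g=(b_1,\ldots,b_{r-1})$ then $h$ has crosses exactly at $b_1,\ldots,b_{r-1},a$) is a bijection from $\flat\bar f$ onto $\flat_{1/2}f$.
   Context: Let $F$ be the set of all functions $f:\mathbb{Z}\to\{\times,\cdot\}$ such that $f(x)=\cdot$ for all but finitely many $x\in\mathbb{Z}$. If $f^{ -1}(\times)=\{a_1<\cdots<a_r\}$ we write $f=(a_1,\ldots,a_r)$ and $\#f=r$; let $F_r=\{f\in F:\#f=r\}$ ($F_0$ consists of the constant function $\cdot$). A cap is an upper half-circle joining two integers $b<a$; it starts at $b$ and ends at $a$. For $g=(b_1,\ldots,b_k)\in F_k$, the cap diagram $D_{cap}(g)$ consists of $k$ caps, one starting at each $b_i$, constructed as follows: for $i=k,k-1,\ldots,1$ in turn, the cap starting at $b_i$ ends at the smallest integer $e>b_i$ such that $g(e)=\cdot$ and $e$ is not already the end of a previously constructed cap. For $f\in F_k$, we say $D_{cap}(g)$ matches the weight diagram of $f$ if every cap of $D_{cap}(g)$ has one endpoint $x$ with $f(x)=\cdot$ and the other endpoint $y$ with $f(y)=\times$. Define $\flat f=\{g\in F_k: D_{cap}(g)\text{ matches the weight diagram of }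 f\}$ (with $k=\#f$). For $f\in F_r$ with largest cross $a=a_r$, define $$\flat_{1/2}f=\{g\in\flat f: D_{cap}(g)\text{ has a cap joining } a \text{ to } a+1\}.$$ -}

module Defs where

open import Data.Nat using (ℕ; zero; suc)
open import Data.Integer using (ℤ; _+_; _<_; _<?_; _≟_; +_)
open import Data.Product using (_×_; _,_; proj₂)
open import Data.Sum using (_⊎_)
open import Data.List using (List; []; _∷_; _++_; map; length; reverse)
open import Data.List.Relation.Unary.All using (All)
open import Data.List.Relation.Unary.Linked using (Linked)
open import Data.List.Membership.Propositional using (_∈_; _∉_)
open import Data.List.Membership.DecPropositional _≟_ using (_∈?_)
open import Relation.Nullary using (yes; no; ¬_)
open import Relation.Binary.PropositionalEquality using (_≡_)

-- An element f of F is represented by the list of its crosses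
-- f⁻¹(×) = (a₁ < ⋯ < a_r), i.e. a strictly increasing list of integers.
-- f(x) = × iff x ∈ f (as a list).
IsF : List ℤ → Set
IsF = Linked _<_

-- Smallest integer ≥ x not in the list `avoid` (bounded search; the fuel
-- suc (length avoid) is always sufficient by pigeonhole).
search : ℕ → List ℤ → ℤ → ℤ
search zero    avoid x = x
search (suc n) avoid x with x ∈? avoid
... | yes _ = search n avoid (x + + 1)
... | no  _ = x

-- A cap is a pair (start , end) with start < end.
-- Process the crosses b_k, b_{k-1}, …, b_1 in turn: the cap starting at b
-- ends at the smallest e > b with g(e) = · and e not already an end.
capsFrom : List ℤ → List ℤ → List (ℤ × ℤ) → List (ℤ × ℤ)
capsFrom g []       acc = acc
capsFrom g (b ∷ bs) acc = capsFrom g bs ((b , e) ∷ acc)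
  where
  avoid : List ℤ
  avoid = g ++ map proj₂ acc
  e : ℤ
  e = search (suc (length avoid)) avoid (b + + 1)

capDiagram : List ℤ → List (ℤ × ℤ)
capDiagram g = capsFrom g (reverse g) []

CapMatches : List ℤ → ℤ × ℤ → Set
CapMatches f (x , y) = (x ∉ f × y ∈ f) ⊎ (x ∈ f × y ∉ f)

Matches : List ℤ → List (ℤ × ℤ) → Set
Matches f caps = All (CapMatches f) caps

InFlat : List ℤ → List ℤ → Set
InFlat f g = IsF g × length g ≡ length f × Matches f (capDiagram g)

-- g ∈ ♭_{1/2} f, where a is the largest cross of f
InFlatHalf : List ℤ → ℤ → List ℤ → Set
InFlatHalf f a g = InFlat f g × (a , a + + 1) ∈ capDiagram g

insert : ℤ → List ℤ → List ℤ
insert a []       = a ∷ []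
insert a (b ∷ bs) with a <? b
... | yes _ = a ∷ b ∷ bs
... | no  _ with a ≟ b
...   | yes _ = b ∷ bs
...   | no  _ = b ∷ insert a bs

-- Every cap of D_cap(g) starts at a cross of g, so if D_cap(g) matches f̄ then all crosses
-- of g lie below a. For such g the cross a is processed first in D_cap(g ∪ {a}) and gets
-- the cap (a, a+1); every later search for a cap end then runs as in D_cap(g), except that
-- the occupied points a and a+1 are jumped over. Hence D_cap(g ∪ {a}) is D_cap(g) with all
-- ends ≥ a moved up by two, plus the cap (a, a+1). Since no point ≥ a is a cross of f̄ and
-- no point > a is a cross of f, this move preserves which ends are crosses, so D_cap(g)
-- matches f̄ iff D_cap(g ∪ {a}) matches f. Conversely, a cap (a, a+1) makes a a cross of h,
-- and matching f bounds every cross of h by a, so h = g ∪ {a} with g below a.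
module Submission where

open import Defs
open import Data.Integer using (ℤ)
open import Data.List using (List; _∷ʳ_)
open import Data.Product using (_×_; Σ-syntax)
open import Relation.Binary.PropositionalEquality using (_≡_)

open import Data.Empty using (⊥-elim)
open import Data.Integer using (+_; _+_; _<_; _≤_; +<+)
open import Data.Integer.Properties
  using (_<?_; _≤?_; _≟_; +-assoc; +-comm; +-identityʳ; +-monoʳ-<; +-mono-≤-<; +-0-abelianGroup
        ; ≤-refl; ≤-trans; ≤-antisym; <-trans; <-≤-trans; ≤-<-trans; <-irrefl; <-asym
        ; <⇒≤; <⇒≱; <⇒≢; ≮⇒≥; i<j⇒suc[i]≤j)
open import Algebra.Properties.AbelianGroup +-0-abelianGroup using (∙-cancelʳ)
open import Data.List using ([]; _∷_; [_]; _++_; map; length; reverse)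
open import Data.List.Properties using (length-++; length-map; reverse-++; reverse-involutive; unfold-reverse; ∷ʳ-++; ++-identityʳ; ∷ʳ-injectiveˡ)
open import Data.List.Membership.Propositional using (_∈_; _∉_)
open import Data.List.Membership.Propositional.Properties using (∈-++⁺ˡ; ∈-++⁺ʳ; ∈-map⁺; ∈-map⁻; ++-∈⇔)
open import Data.List.Membership.DecPropositional _≟_ using (_∈?_)
open import Data.List.Relation.Unary.All as All using (All; []; _∷_)
import Data.List.Relation.Unary.All.Properties as Allₚ
open import Data.List.Relation.Unary.Any using (here; there)
import Data.List.Relation.Unary.Any.Properties as Anyₚ
open import Data.List.Relation.Unary.Linked using (Linked; []; [-]; _∷_)
open import Data.Nat using (ℕ; zero; suc; s≤s; z≤n) renaming (_+_ to _+ℕ_; _≤_ to _≤ℕ_; _<_ to _<ℕ_)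
import Data.Nat.Properties as ℕ
open import Data.Product using (_,_; proj₁; proj₂; map₂; uncurry)
open import Data.Sum using (_⊎_; inj₁; inj₂)
open import Data.Sum.Function.Propositional using (_⊎-⇔_)
open import Function using (_∘_)
open import Function.Bundles using (_⇔_; mk⇔; Equivalence)
open import Function.Properties.Equivalence using () renaming (sym to ⇔-sym; trans to ⇔-trans)
open import Function.Related.Propositional using (module EquationalReasoning)
open import Relation.Binary.Definitions using (Transitive)
open import Relation.Binary.PropositionalEquality using (_≢_; refl; sym; trans; cong; cong₂; subst; module ≡-Reasoning)
open import Relation.Nullary using (yes; no)

open Equivalence using (to; from)

i<i+[1+n] : ∀ i n → i < i + + suc n
i<i+[1+n] i n = subst (_< i + + suc n) (+-identityʳ i) (+-monoʳ-< i (+<+ (s≤s z≤n)))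

i<i+1 : ∀ i → i < i + + 1
i<i+1 i = i<i+[1+n] i 0

i<j⇒i+1≤j : ∀ {i j} → i < j → i + + 1 ≤ j
i<j⇒i+1≤j {i} i<j = subst (_≤ _) (+-comm (+ 1) i) (i<j⇒suc[i]≤j i<j)

i≤j⇒i<j+2 : ∀ {i j} → i ≤ j → i < j + + 2
i≤j⇒i<j+2 {j = j} i≤j = ≤-<-trans i≤j (i<i+[1+n] j 1)

i≤j⇒i+1<j+2 : ∀ {i j} → i ≤ j → i + + 1 < j + + 2
i≤j⇒i+1<j+2 i≤j = +-mono-≤-< i≤j (+<+ (s≤s (s≤s z≤n)))

i+2+1≡i+1+2 : ∀ i → i + + 2 + + 1 ≡ i + + 1 + + 2
i+2+1≡i+1+2 i = trans (+-assoc i (+ 2) (+ 1)) (sym (+-assoc i (+ 1) (+ 2)))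

length-∷ʳ : ∀ {A : Set} (xs : List A) {x} → length (xs ∷ʳ x) ≡ suc (length xs)
length-∷ʳ xs = trans (length-++ xs) (ℕ.+-comm (length xs) 1)

length-∷ʳ-≡⇔ : ∀ {A : Set} (xs ys : List A) {x y} →
  (length (xs ∷ʳ x) ≡ length (ys ∷ʳ y)) ⇔ (length xs ≡ length ys)
length-∷ʳ-≡⇔ xs ys = mk⇔
  (λ eq → ℕ.suc-injective (trans (sym (length-∷ʳ xs)) (trans eq (length-∷ʳ ys))))
  (λ eq → trans (length-∷ʳ xs) (trans (cong suc eq) (sym (length-∷ʳ ys))))

∈-∷ʳ-≢⇔ : ∀ {A : Set} {x z : A} {xs} → x ≢ z → (x ∈ xs ∷ʳ z) ⇔ (x ∈ xs)
∈-∷ʳ-≢⇔ {x = x} {z} {xs} x≢z = mk⇔ ∈-∷ʳ⁻ ∈-++⁺ˡ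
  where
  ∈-∷ʳ⁻ : x ∈ xs ∷ʳ z → x ∈ xs
  ∈-∷ʳ⁻ m with to ++-∈⇔ m
  ... | inj₁ x∈xs = x∈xs
  ... | inj₂ (here x≡z) = ⊥-elim (x≢z x≡z)

module _ {A : Set} {R : A → A → Set} where

  linked-∷ʳ⁺ : ∀ {x} xs → Linked R xs → All (λ y → R y x) xs → Linked R (xs ∷ʳ x)
  linked-∷ʳ⁺ []           []         []         = [-]
  linked-∷ʳ⁺ (y ∷ [])     [-]        (Ryx ∷ []) = Ryx ∷ [-]
  linked-∷ʳ⁺ (y ∷ z ∷ xs) (Ryz ∷ Rs) (_ ∷ Rxs)  = Ryz ∷ linked-∷ʳ⁺ (z ∷ xs) Rs Rxs

  linked-∷ʳ⁻ : ∀ {x} xs → Linked R (xs ∷ʳ x) → Linked R xs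
  linked-∷ʳ⁻ []           _          = []
  linked-∷ʳ⁻ (y ∷ [])     _          = [-]
  linked-∷ʳ⁻ (y ∷ z ∷ xs) (Ryz ∷ Rs) = Ryz ∷ linked-∷ʳ⁻ (z ∷ xs) Rs

  linked-∷ʳ⇒All : Transitive R → ∀ {x} xs → Linked R (xs ∷ʳ x) → All (λ y → R y x) xs
  linked-∷ʳ⇒All R-trans []           _          = []
  linked-∷ʳ⇒All R-trans (y ∷ [])     (Ryx ∷ [-]) = Ryx ∷ []
  linked-∷ʳ⇒All R-trans (y ∷ z ∷ xs) (Ryz ∷ Rs) with linked-∷ʳ⇒All R-trans (z ∷ xs) Rs
  ... | Rzx ∷ Rxs = R-trans Ryz Rzx ∷ Rzx ∷ Rxs

sorted-max⇒∷ʳ : ∀ {a} h → Linked _<_ h → All (_≤ a) h → a ∈ h →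
  Σ[ g ∈ List ℤ ] All (_< a) g × h ≡ g ∷ʳ a
sorted-max⇒∷ʳ (x ∷ [])     _         _             (here refl) = [] , [] , refl
sorted-max⇒∷ʳ (x ∷ y ∷ xs) (x<y ∷ _) (_ ∷ y≤a ∷ _) (here refl) = ⊥-elim (<⇒≱ x<y y≤a)
sorted-max⇒∷ʳ (x ∷ y ∷ xs) (x<y ∷ s) (_ ∷ ys≤a)    (there a∈)  with sorted-max⇒∷ʳ (y ∷ xs) s ys≤a a∈
... | g , g<a , eq = x ∷ g , <-≤-trans x<y (All.head ys≤a) ∷ g<a , cong (x ∷_) eq

insert-∷ʳ : ∀ {a} {g} → All (_< a) g → insert a g ≡ g ∷ʳ a
insert-∷ʳ             []          = refl
insert-∷ʳ {a} {b ∷ g} (b<a ∷ g<a) with a <? b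
... | yes a<b = ⊥-elim (<-asym a<b b<a)
... | no _ with a ≟ b
...   | yes refl = ⊥-elim (<-irrefl refl b<a)
...   | no _     = cong (b ∷_) (insert-∷ʳ g<a)

-- Fuel n > count≥ x av suffices for `search n av x` to reach a point outside av.
count≥ : ℤ → List ℤ → ℕ
count≥ x []       = 0
count≥ x (y ∷ ys) with x ≤? y
... | yes _ = suc (count≥ x ys)
... | no  _ = count≥ x ys

count≥-≤-length : ∀ x ys → count≥ x ys ≤ℕ length ys
count≥-≤-length x []       = z≤n
count≥-≤-length x (y ∷ ys) with x ≤? y
... | yes _ = s≤s (count≥-≤-length x ys)
... | no  _ = ℕ.m≤n⇒m≤1+n (count≥-≤-length x ys)

count≥-antimono : ∀ {x x′} → x ≤ x′ → ∀ ys → count≥ x′ ys ≤ℕ count≥ x ys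
count≥-antimono x≤x′ []       = z≤n
count≥-antimono {x} {x′} x≤x′ (y ∷ ys) with x′ ≤? y | x ≤? y
... | yes _    | yes _   = s≤s (count≥-antimono x≤x′ ys)
... | yes x′≤y | no x≰y  = ⊥-elim (x≰y (≤-trans x≤x′ x′≤y))
... | no _     | yes _   = ℕ.m≤n⇒m≤1+n (count≥-antimono x≤x′ ys)
... | no _     | no _    = count≥-antimono x≤x′ ys

count≥-∈ : ∀ {x ys} → x ∈ ys → count≥ (x + + 1) ys <ℕ count≥ x ys
count≥-∈ {x} {.x ∷ ys} (here refl) with x + + 1 ≤? x | x ≤? x
... | yes x+1≤x | _       = ⊥-elim (<⇒≱ (i<i+1 x) x+1≤x)
... | no _      | yes _   = s≤s (count≥-antimono (<⇒≤ (i<i+1 x)) ys)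
... | no _      | no x≰x  = ⊥-elim (x≰x ≤-refl)
count≥-∈ {x} {y ∷ ys} (there x∈) with x + + 1 ≤? y | x ≤? y
... | yes _     | yes _   = s≤s (count≥-∈ x∈)
... | yes x+1≤y | no x≰y  = ⊥-elim (x≰y (≤-trans (<⇒≤ (i<i+1 x)) x+1≤y))
... | no _      | yes _   = ℕ.m≤n⇒m≤1+n (count≥-∈ x∈)
... | no _      | no _    = count≥-∈ x∈

search-∈ : ∀ {n av x} → x ∈ av → search (suc n) av x ≡ search n av (x + + 1)
search-∈ {n} {av} {x} x∈ with x ∈? av
... | yes _  = refl
... | no x∉ = ⊥-elim (x∉ x∈)

search-∉ : ∀ {n av x} → x ∉ av → search (suc n) av x ≡ x
search-∉ {n} {av} {x} x∉ with x ∈? av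
... | yes x∈ = ⊥-elim (x∉ x∈)
... | no _   = refl

search-≥ : ∀ n av x → x ≤ search n av x
search-≥ zero    av x = ≤-refl
search-≥ (suc n) av x with x ∈? av
... | yes _ = ≤-trans (<⇒≤ (i<i+1 x)) (search-≥ n av (x + + 1))
... | no  _ = ≤-refl

capEnd : List ℤ → List (ℤ × ℤ) → ℤ → ℤ
capEnd g acc b = search (suc (length (g ++ map proj₂ acc))) (g ++ map proj₂ acc) (b + + 1)

capsFrom-starts : ∀ g bs acc → map proj₁ (capsFrom g bs acc) ≡ reverse bs ++ map proj₁ acc
capsFrom-starts g []       acc = refl
capsFrom-starts g (b ∷ bs) acc = begin
  map proj₁ (capsFrom g bs ((b , capEnd g acc b) ∷ acc)) ≡⟨ capsFrom-starts g bs _ ⟩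
  reverse bs ++ b ∷ map proj₁ acc                          ≡⟨ ∷ʳ-++ (reverse bs) b _ ⟨
  (reverse bs ∷ʳ b) ++ map proj₁ acc                       ≡⟨ cong (_++ map proj₁ acc) (unfold-reverse b bs) ⟨
  reverse (b ∷ bs) ++ map proj₁ acc                        ∎
  where open ≡-Reasoning

capDiagram-starts : ∀ g → map proj₁ (capDiagram g) ≡ g
capDiagram-starts g = trans (capsFrom-starts g (reverse g) []) (trans (++-identityʳ _) (reverse-involutive g))

capsFrom-increasing : ∀ g bs acc → All (uncurry _<_) acc → All (uncurry _<_) (capsFrom g bs acc)
capsFrom-increasing g []       acc inc = inc
capsFrom-increasing g (b ∷ bs) acc inc = capsFrom-increasing g bs _ (b<end ∷ inc)
  where
  b<end : b < capEnd g acc b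
  b<end = <-≤-trans (i<i+1 b) (search-≥ (suc (length (g ++ map proj₂ acc))) (g ++ map proj₂ acc) (b + + 1))

capDiagram-increasing : ∀ g → All (uncurry _<_) (capDiagram g)
capDiagram-increasing g = capsFrom-increasing g (reverse g) [] []

All-capDiagram⁺ : ∀ {P : ℤ → Set} {g} → All P g → All (P ∘ proj₁) (capDiagram g)
All-capDiagram⁺ {P} {g} Pg = Allₚ.map⁻ (subst (All P) (sym (capDiagram-starts g)) Pg)

matched-starts : ∀ {P : ℤ → Set} {f g} → (∀ {x y} → x < y → P y → P x) →
  All P f → Matches f (capDiagram g) → All P g
matched-starts {P} {f} {g} P-down Pf m =
  subst (All P) (capDiagram-starts g) (Allₚ.map⁺ (All.zipWith start-P (m , capDiagram-increasing g)))
  where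
  start-P : ∀ {c} → CapMatches f c × uncurry _<_ c → P (proj₁ c)
  start-P (inj₁ (_ , y∈f) , x<y) = P-down x<y (All.lookup Pf y∈f)
  start-P (inj₂ (x∈f , _) , _)   = All.lookup Pf x∈f

CapMatches-cong : ∀ {f f′ x x′ y y′} → (x ∈ f) ⇔ (x′ ∈ f′) → (y ∈ f) ⇔ (y′ ∈ f′) →
  CapMatches f (x , y) ⇔ CapMatches f′ (x′ , y′)
CapMatches-cong x⇔ y⇔ = mk⇔ (resp x⇔ y⇔) (resp (⇔-sym x⇔) (⇔-sym y⇔))
  where
  resp : ∀ {f f′ x x′ y y′} → (x ∈ f) ⇔ (x′ ∈ f′) → (y ∈ f) ⇔ (y′ ∈ f′) →
    CapMatches f (x , y) → CapMatches f′ (x′ , y′)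
  resp x⇔ y⇔ (inj₁ (x∉ , y∈)) = inj₁ (x∉ ∘ from x⇔ , to y⇔ y∈)
  resp x⇔ y⇔ (inj₂ (x∈ , y∉)) = inj₂ (to x⇔ x∈ , y∉ ∘ from y⇔)

module Shift (a : ℤ) where

  shift : ℤ → ℤ
  shift y with y <? a
  ... | yes _ = y
  ... | no  _ = y + + 2

  shiftEnd : ℤ × ℤ → ℤ × ℤ
  shiftEnd = map₂ shift

  shift-< : ∀ {y} → y < a → shift y ≡ y
  shift-< {y} y<a with y <? a
  ... | yes _  = refl
  ... | no y≮a = ⊥-elim (y≮a y<a)

  shift-≥ : ∀ {y} → a ≤ y → shift y ≡ y + + 2
  shift-≥ {y} a≤y with y <? a
  ... | yes y<a = ⊥-elim (<⇒≱ y<a a≤y)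
  ... | no _    = refl

  shift<a⇒≡ : ∀ {y} → shift y < a → shift y ≡ y
  shift<a⇒≡ {y} s<a with y <? a
  ... | yes _  = refl
  ... | no y≮a = ⊥-elim (<-asym s<a (i≤j⇒i<j+2 (≮⇒≥ y≮a)))

  shift≢a : ∀ y → shift y ≢ a
  shift≢a y eq with y <? a
  ... | yes y<a = <-irrefl eq y<a
  ... | no y≮a  = <-irrefl (sym eq) (i≤j⇒i<j+2 (≮⇒≥ y≮a))

  shift≢a+1 : ∀ y → shift y ≢ a + + 1
  shift≢a+1 y eq with y <? a
  ... | yes y<a = <-irrefl eq (<-trans y<a (i<i+1 a))
  ... | no y≮a  = <-irrefl (sym eq) (i≤j⇒i+1<j+2 (≮⇒≥ y≮a))

  shift-injective : ∀ {y z} → shift y ≡ shift z → y ≡ z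
  shift-injective {y} {z} eq with y <? a | z <? a
  ... | yes _   | yes _   = eq
  ... | yes y<a | no z≮a  = ⊥-elim (<-asym y<a (subst (a <_) (sym eq) (i≤j⇒i<j+2 (≮⇒≥ z≮a))))
  ... | no y≮a  | yes z<a = ⊥-elim (<-asym z<a (subst (a <_) eq (i≤j⇒i<j+2 (≮⇒≥ y≮a))))
  ... | no _    | no _    = ∙-cancelʳ (+ 2) y z eq

  shift-∈⇔ : ∀ {xs y} → All (_< a) xs → (shift y ∈ xs) ⇔ (y ∈ xs)
  shift-∈⇔ {xs} xs<a = mk⇔
    (λ s∈ → subst (_∈ xs) (shift<a⇒≡ (All.lookup xs<a s∈)) s∈)
    (λ y∈ → subst (_∈ xs) (sym (shift-< (All.lookup xs<a y∈))) y∈)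

  shift-∈-map⇔ : ∀ {E y} → (shift y ∈ map shift E) ⇔ (y ∈ E)
  shift-∈-map⇔ {E} = mk⇔ shift-∈-map⁻ (∈-map⁺ shift)
    where
    shift-∈-map⁻ : ∀ {y} → shift y ∈ map shift E → y ∈ E
    shift-∈-map⁻ s∈ with ∈-map⁻ shift s∈
    ... | e , e∈ , eq = subst (_∈ E) (sym (shift-injective eq)) e∈

  module SearchShift (av₀ av₁ : List ℤ) (shift-∈-av⇔ : ∀ y → (shift y ∈ av₁) ⇔ (y ∈ av₀))
                     (a∈av₁ : a ∈ av₁) (a+1∈av₁ : a + + 1 ∈ av₁) where
    open ≡-Reasoning

    ∈-below⇔ : ∀ {y} → y < a → (y ∈ av₁) ⇔ (y ∈ av₀)
    ∈-below⇔ {y} y<a = subst (λ z → (z ∈ av₁) ⇔ (y ∈ av₀)) (shift-< y<a) (shift-∈-av⇔ y)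

    ∈-above⇔ : ∀ {y} → a ≤ y → (y + + 2 ∈ av₁) ⇔ (y ∈ av₀)
    ∈-above⇔ {y} a≤y = subst (λ z → (z ∈ av₁) ⇔ (y ∈ av₀)) (shift-≥ a≤y) (shift-∈-av⇔ y)

    search-above : ∀ n {y} → a ≤ y → search n av₁ (y + + 2) ≡ search n av₀ y + + 2
    search-above zero    _ = refl
    search-above (suc n) {y} a≤y with y ∈? av₀
    ... | no y∉  = search-∉ (y∉ ∘ to (∈-above⇔ a≤y))
    ... | yes y∈ = begin
      search (suc n) av₁ (y + + 2)  ≡⟨ search-∈ (from (∈-above⇔ a≤y) y∈) ⟩
      search n av₁ (y + + 2 + + 1)  ≡⟨ cong (search n av₁) (i+2+1≡i+1+2 y) ⟩
      search n av₁ (y + + 1 + + 2)  ≡⟨ search-above n (≤-trans a≤y (<⇒≤ (i<i+1 y))) ⟩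
      search n av₀ (y + + 1) + + 2  ∎

    search-gap : ∀ n → search (suc (suc n)) av₁ a ≡ shift (search n av₀ a)
    search-gap n = begin
      search (suc (suc n)) av₁ a    ≡⟨ search-∈ a∈av₁ ⟩
      search (suc n) av₁ (a + + 1)  ≡⟨ search-∈ a+1∈av₁ ⟩
      search n av₁ (a + + 1 + + 1)  ≡⟨ cong (search n av₁) (+-assoc a (+ 1) (+ 1)) ⟩
      search n av₁ (a + + 2)        ≡⟨ search-above n ≤-refl ⟩
      search n av₀ a + + 2          ≡⟨ shift-≥ (search-≥ n av₀ a) ⟨
      shift (search n av₀ a)        ∎

    search-shift : ∀ n {x} → x ≤ a → count≥ x av₀ <ℕ n →
      search (suc (suc n)) av₁ x ≡ shift (search n av₀ x)
    search-shift zero    _   ()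
    search-shift (suc n) {x} x≤a fuel with x <? a
    ... | no x≮a with refl ← ≤-antisym x≤a (≮⇒≥ x≮a) = search-gap (suc n)
    ... | yes x<a with x ∈? av₀
    ...   | no x∉  = trans (search-∉ (x∉ ∘ to (∈-below⇔ x<a))) (sym (shift-< x<a))
    ...   | yes x∈ = trans (search-∈ (from (∈-below⇔ x<a) x∈))
                           (search-shift n (i<j⇒i+1≤j x<a) (ℕ.≤-trans (count≥-∈ x∈) (ℕ.≤-pred fuel)))

  module _ (g : List ℤ) (g<a : All (_< a) g) where
    open ≡-Reasoning

    shift-∈-avoid⇔ : ∀ E y → (shift y ∈ (g ∷ʳ a) ++ (map shift E ∷ʳ (a + + 1))) ⇔ (y ∈ g ++ E)
    shift-∈-avoid⇔ E y = begin⇔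
      shift y ∈ (g ∷ʳ a) ++ (map shift E ∷ʳ (a + + 1))         ∼⟨ ++-∈⇔ ⟩
      (shift y ∈ g ∷ʳ a ⊎ shift y ∈ map shift E ∷ʳ (a + + 1))  ∼⟨ ∈-∷ʳ-≢⇔ (shift≢a y) ⊎-⇔ ∈-∷ʳ-≢⇔ (shift≢a+1 y) ⟩
      (shift y ∈ g ⊎ shift y ∈ map shift E)                    ∼⟨ shift-∈⇔ g<a ⊎-⇔ shift-∈-map⇔ ⟩
      (y ∈ g ⊎ y ∈ E)                                          ∼⟨ ⇔-sym ++-∈⇔ ⟩
      y ∈ g ++ E                                               ∎⇔
      where open EquationalReasoning renaming (begin_ to begin⇔_; _∎ to _∎⇔)

    length-avoid : ∀ E → length ((g ∷ʳ a) ++ (map shift E ∷ʳ (a + + 1))) ≡ suc (suc (length (g ++ E)))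
    length-avoid E = begin
      length ((g ∷ʳ a) ++ (map shift E ∷ʳ (a + + 1)))        ≡⟨ length-++ (g ∷ʳ a) ⟩
      length (g ∷ʳ a) +ℕ length (map shift E ∷ʳ (a + + 1))  ≡⟨ cong₂ _+ℕ_ (length-∷ʳ g) (trans (length-∷ʳ (map shift E)) (cong suc (length-map shift E))) ⟩
      suc (length g) +ℕ suc (length E)                       ≡⟨ cong suc (ℕ.+-suc (length g) (length E)) ⟩
      suc (suc (length g +ℕ length E))                       ≡⟨ cong (suc ∘ suc) (length-++ g) ⟨
      suc (suc (length (g ++ E)))                             ∎

    ends-shiftEnd : ∀ acc → map proj₂ (map shiftEnd acc ∷ʳ (a , a + + 1)) ≡ map shift (map proj₂ acc) ∷ʳ (a + + 1)
    ends-shiftEnd []        = refl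
    ends-shiftEnd (c ∷ acc) = cong (shift (proj₂ c) ∷_) (ends-shiftEnd acc)

    capEnd-∷ʳ : ∀ acc {b} → b < a → capEnd (g ∷ʳ a) (map shiftEnd acc ∷ʳ (a , a + + 1)) b ≡ shift (capEnd g acc b)
    capEnd-∷ʳ acc {b} b<a rewrite ends-shiftEnd acc | length-avoid (map proj₂ acc) =
      search-shift (suc (length (g ++ E))) (i<j⇒i+1≤j b<a) (s≤s (count≥-≤-length (b + + 1) (g ++ E)))
      where
      E = map proj₂ acc
      open SearchShift (g ++ E) ((g ∷ʳ a) ++ (map shift E ∷ʳ (a + + 1))) (shift-∈-avoid⇔ E)
        (∈-++⁺ˡ (∈-++⁺ʳ g (here refl))) (∈-++⁺ʳ (g ∷ʳ a) (∈-++⁺ʳ (map shift E) (here refl)))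

    capsFrom-∷ʳ : ∀ bs acc → All (_< a) bs →
      capsFrom (g ∷ʳ a) bs (map shiftEnd acc ∷ʳ (a , a + + 1)) ≡ map shiftEnd (capsFrom g bs acc) ∷ʳ (a , a + + 1)
    capsFrom-∷ʳ []       acc []          = refl
    capsFrom-∷ʳ (b ∷ bs) acc (b<a ∷ bs<a) = begin
      capsFrom (g ∷ʳ a) bs ((b , capEnd (g ∷ʳ a) (map shiftEnd acc ∷ʳ (a , a + + 1)) b) ∷ map shiftEnd acc ∷ʳ (a , a + + 1))
        ≡⟨ cong (λ e → capsFrom (g ∷ʳ a) bs ((b , e) ∷ map shiftEnd acc ∷ʳ (a , a + + 1))) (capEnd-∷ʳ acc b<a) ⟩
      capsFrom (g ∷ʳ a) bs (map shiftEnd ((b , capEnd g acc b) ∷ acc) ∷ʳ (a , a + + 1))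
        ≡⟨ capsFrom-∷ʳ bs ((b , capEnd g acc b) ∷ acc) bs<a ⟩
      map shiftEnd (capsFrom g (b ∷ bs) acc) ∷ʳ (a , a + + 1)
        ∎

    capDiagram-∷ʳ : capDiagram (g ∷ʳ a) ≡ map shiftEnd (capDiagram g) ∷ʳ (a , a + + 1)
    capDiagram-∷ʳ = begin
      capsFrom (g ∷ʳ a) (reverse (g ∷ʳ a)) []                          ≡⟨ cong (λ bs → capsFrom (g ∷ʳ a) bs []) (reverse-++ g [ a ]) ⟩
      capsFrom (g ∷ʳ a) (reverse g) [ (a , capEnd (g ∷ʳ a) [] a) ]   ≡⟨ cong (λ e → capsFrom (g ∷ʳ a) (reverse g) [ (a , e) ]) (search-∉ a+1∉) ⟩
      capsFrom (g ∷ʳ a) (reverse g) [ (a , a + + 1) ]                 ≡⟨ capsFrom-∷ʳ (reverse g) [] reverse-g<a ⟩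
      map shiftEnd (capDiagram g) ∷ʳ (a , a + + 1)                    ∎
      where
      reverse-g<a : All (_< a) (reverse g)
      reverse-g<a = All.tabulate (All.lookup g<a ∘ Anyₚ.reverse⁻)
      a+1∉ : a + + 1 ∉ (g ∷ʳ a) ++ []
      a+1∉ a+1∈ = <-irrefl refl (All.lookup below-a+1 a+1∈)
        where
        below-a+1 : All (_< a + + 1) ((g ∷ʳ a) ++ [])
        below-a+1 = Allₚ.++⁺ (Allₚ.++⁺ (All.map (λ y<a → <-trans y<a (i<i+1 a)) g<a) (i<i+1 a ∷ [])) []

module Flat (fbar : List ℤ) (a : ℤ) (fbar<a : All (_< a) fbar) where
  open Shift a

  f : List ℤ
  f = fbar ∷ʳ a

  capMatches-shiftEnd⇔ : ∀ {x y} → x < a → CapMatches fbar (x , y) ⇔ CapMatches f (x , shift y)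
  capMatches-shiftEnd⇔ {x} {y} x<a = CapMatches-cong
    (⇔-sym (∈-∷ʳ-≢⇔ (<⇒≢ x<a)))
    (⇔-sym (⇔-trans (∈-∷ʳ-≢⇔ (shift≢a y)) (shift-∈⇔ fbar<a)))

  matches-shiftEnd⇔ : ∀ {caps} → All ((_< a) ∘ proj₁) caps →
    Matches fbar caps ⇔ Matches f (map shiftEnd caps)
  matches-shiftEnd⇔ starts<a = mk⇔
    (λ m → Allₚ.map⁺ (All.zipWith (λ (x<a , mc) → to (capMatches-shiftEnd⇔ x<a) mc) (starts<a , m)))
    (λ m → All.zipWith (λ (x<a , mc) → from (capMatches-shiftEnd⇔ x<a) mc) (starts<a , Allₚ.map⁻ m))

  flat-below : ∀ {g} → InFlat fbar g → All (_< a) g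
  flat-below (_ , _ , m) = matched-starts <-trans fbar<a m

  flatHalf-∷ʳ⁺ : ∀ {g} → InFlat fbar g → InFlatHalf f a (g ∷ʳ a)
  flatHalf-∷ʳ⁺ {g} g∈@(g-sorted , |g| , m) =
    (linked-∷ʳ⁺ g g-sorted g<a , from (length-∷ʳ-≡⇔ g fbar) |g| , m′) , cap∈
    where
    g<a = flat-below g∈
    a∈f : a ∈ f
    a∈f = ∈-++⁺ʳ fbar (here refl)
    a+1∉f : a + + 1 ∉ f
    a+1∉f a+1∈ = <-irrefl refl (All.lookup (Allₚ.++⁺ (All.map (λ y<a → <-trans y<a (i<i+1 a)) fbar<a) (i<i+1 a ∷ [])) a+1∈)
    m′ : Matches f (capDiagram (g ∷ʳ a))
    m′ rewrite capDiagram-∷ʳ g g<a =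
      Allₚ.++⁺ (to (matches-shiftEnd⇔ (All-capDiagram⁺ g<a)) m) (inj₂ (a∈f , a+1∉f) ∷ [])
    cap∈ : (a , a + + 1) ∈ capDiagram (g ∷ʳ a)
    cap∈ rewrite capDiagram-∷ʳ g g<a = ∈-++⁺ʳ (map shiftEnd (capDiagram g)) (here refl)

  flat-∷ʳ⁻ : ∀ {g} → All (_< a) g → InFlat f (g ∷ʳ a) → InFlat fbar g
  flat-∷ʳ⁻ {g} g<a (sorted , |g∷ʳa| , m) =
    linked-∷ʳ⁻ g sorted , to (length-∷ʳ-≡⇔ g fbar) |g∷ʳa| ,
    from (matches-shiftEnd⇔ (All-capDiagram⁺ g<a)) (Allₚ.++⁻ˡ _ (subst (Matches f) (capDiagram-∷ʳ g g<a) m))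

  flatHalf-∷ʳ⁻ : ∀ {h} → InFlatHalf f a h → Σ[ g ∈ List ℤ ] All (_< a) g × h ≡ g ∷ʳ a
  flatHalf-∷ʳ⁻ {h} ((sorted , _ , m) , cap∈) = sorted-max⇒∷ʳ h sorted h≤a a∈h
    where
    f≤a : All (_≤ a) f
    f≤a = Allₚ.++⁺ (All.map <⇒≤ fbar<a) (≤-refl ∷ [])
    h≤a : All (_≤ a) h
    h≤a = matched-starts (λ x<y y≤a → <⇒≤ (<-≤-trans x<y y≤a)) f≤a m
    a∈h : a ∈ h
    a∈h = subst (a ∈_) (capDiagram-starts h) (∈-map⁺ proj₁ cap∈)

lemma0p3 : (fbar : List ℤ) (a : ℤ) → IsF (fbar ∷ʳ a) →
    ((g : List ℤ) → InFlat fbar g → InFlatHalf (fbar ∷ʳ a) a (insert a g))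
    × ((g g′ : List ℤ) → InFlat fbar g → InFlat fbar g′ → insert a g ≡ insert a g′ → g ≡ g′)
    × ((h : List ℤ) → InFlatHalf (fbar ∷ʳ a) a h → Σ[ g ∈ List ℤ ] (InFlat fbar g × insert a g ≡ h))
lemma0p3 fbar a f-sorted =
    (λ g g∈ → subst (InFlatHalf f a) (sym (insert-∷ʳ (flat-below g∈))) (flatHalf-∷ʳ⁺ g∈))
  , (λ g g′ g∈ g′∈ eq → ∷ʳ-injectiveˡ g g′
      (trans (sym (insert-∷ʳ (flat-below g∈))) (trans eq (insert-∷ʳ (flat-below g′∈)))))
  , surjective
  where
  open Flat fbar a (linked-∷ʳ⇒All <-trans fbar f-sorted)
  surjective : (h : List ℤ) → InFlatHalf f a h → Σ[ g ∈ List ℤ ] (InFlat fbar g × insert a g ≡ h)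
  surjective h h∈ with flatHalf-∷ʳ⁻ h∈
  ... | g , g<a , refl = g , flat-∷ʳ⁻ g<a (proj₁ h∈) , insert-∷ʳ g<a
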